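{- Let $\lambda$ be a nonzero real number. For integers $n\ge 0$ let $(x)_{0,\mu}=1$ and $(x)_{n,\mu}=x(x-\mu)\cdots(x-(n-1)\mu)$ for $n\ge1$, for any nonzero parameter $\mu$, and let $(x)_n=x(x-1)\cdots(x-n+1)$, $(x)_0=1$. Define the degenerate Stirling numbers of the second kind ${n \brace k}_{\lambda}$ by $(x)_{n,\lambda}=\sum_{k=0}^{n}{n \brace k}_{\lambda}(x)_{k}$. Define the degenerate Eulerian polynomials with parameter $\mu$ by $\sum_{j=0}^{\infty}(j+1)_{n,\mu}x^{j}=\frac{A_{n,\mu}(x)}{(1-x)^{n+1}}$ for $|x|<1$, and the degenerate Eulerian numbers by $A_{n,\mu}(x)=\sum_{k=0}^{n}A_{\mu}(n,k)x^{k}$. Then for $n\ge k\ge0$, \[{n \brace k}_{\lambda}=\frac{1}{k!}\sum_{j=0}^{n}A_{ -\lambda}(n,j)\binom{j}{n-k}.\]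
   Context: $A_{ -\lambda}(n,j)$ is the degenerate Eulerian number with parameter $\mu=-\lambda$. -}

module Defs where

open import Level using (Level; _⊔_) renaming (suc to lsuc)
open import Data.Nat using (ℕ; zero; suc; _∸_; NonZero; _!)
open import Data.Nat.Properties using (_!≢0)
open import Data.Nat.Combinatorics using (_C_)
open import Algebra.Bundles using (CommutativeRing)
open import Relation.Nullary using (¬_)

module RingOps {c ℓ : Level} (R : CommutativeRing c ℓ) where
  open CommutativeRing R

  fromℕ : ℕ → Carrier
  fromℕ zero    = 0#
  fromℕ (suc n) = 1# + fromℕ n

  sumTo : ℕ → (ℕ → Carrier) → Carrier
  sumTo zero    f = f 0
  sumTo (suc n) f = sumTo n f + f (suc n)

  sign : ℕ → Carrier
  sign zero    = 1#
  sign (suc i) = - sign i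

  degFall : Carrier → Carrier → ℕ → Carrier
  degFall μ x zero    = 1#
  degFall μ x (suc n) = degFall μ x n * (x - fromℕ n * μ)

  fall : Carrier → ℕ → Carrier
  fall x n = degFall 1# x n

  Series : Set c
  Series = ℕ → Carrier

  _⊛_ : Series → Series → Series
  (f ⊛ g) m = sumTo m (λ i → f i * g (m ∸ i))

  one : Series
  one zero    = 1#
  one (suc _) = 0#

  oneMinusX : Series
  oneMinusX zero          = 1#
  oneMinusX (suc zero)    = - 1#
  oneMinusX (suc (suc _)) = 0#

  seriesPow : Series → ℕ → Series
  seriesPow f zero    = one
  seriesPow f (suc n) = seriesPow f n ⊛ f

  degGen : Carrier → ℕ → Series
  degGen μ n j = degFall μ (fromℕ (suc j)) n

  degEulerian : Carrier → ℕ → ℕ → Carrier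
  degEulerian μ n k = (seriesPow oneMinusX (suc n) ⊛ degGen μ n) k

-- A field of characteristic zero (ℝ is an instance).
record CharZeroField (c ℓ : Level) : Set (lsuc (c ⊔ ℓ)) where
  field
    commutativeRing : CommutativeRing c ℓ
  open CommutativeRing commutativeRing public
  open RingOps commutativeRing public
  field
    inv        : (x : Carrier) → ¬ (x ≈ 0#) → Carrier
    inverseʳ   : (x : Carrier) (p : ¬ (x ≈ 0#)) → x * inv x p ≈ 1#
    charZero   : (n : ℕ) → ¬ (fromℕ (suc n) ≈ 0#)

  fromℕ-nonZero : (m : ℕ) → .{{NonZero m}} → ¬ (fromℕ m ≈ 0#)
  fromℕ-nonZero (suc n) = charZero n

  invFactorial : ℕ → Carrier
  invFactorial k = inv (fromℕ (k !)) (fromℕ-nonZero (k !) {{k !≢0}})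

{-# OPTIONS --safe #-}

-- Since (x)_{n,-λ} = (-1)ⁿ (-x)_{n,λ}, expanding (-x)_{n,λ} in falling factorials writes
-- (j+1)_{n,-λ} as Σᵢ (-1)ⁿ⁻ⁱ S(n,i) ⟨j+1⟩ᵢ with rising factorials ⟨y⟩ᵢ = (-1)ⁱ (-y)ᵢ.
-- As Σⱼ ⟨j+1⟩ᵢ xʲ = i! / (1 - x)ⁱ⁺¹, this gives A_{n,-λ}(x) = Σᵢ (-1)ⁿ⁻ⁱ i! S(n,i) (1 - x)ⁿ⁻ⁱ.
-- Finally Σⱼ [xʲ]p · C(j,r) is the coefficient of yʳ in p(1 + y), which for p = (1 - x)ᴺ = (-y)ᴺ
-- is (-1)ᴺ δ_{N,r}; for r = n - k only the term i = k survives.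
module Submission where

open import Defs
open import Level using (Level)
open import Data.Nat as ℕ using (ℕ; _≤_; _∸_; zero; suc; z≤n; s≤s; _!)
open import Data.Nat.Combinatorics using (_C_; nCk+nC[k+1]≡[n+1]C[k+1])
open import Relation.Nullary using (¬_; yes; no; contradiction)

import Data.Nat.Properties as ℕ
open import Data.Integer as ℤ using (ℤ; +_; -[1+_]; _⊖_; _◃_)
import Data.Integer.Properties as ℤ
open import Data.Sign as Sign using (Sign)
open import Data.Maybe using (Maybe; just; nothing)
open import Function.Base using (_∘_)
open import Relation.Binary.PropositionalEquality as ≡ using (_≡_; _≢_)
open import Algebra.Bundles using (CommutativeRing)
open import Algebra.Solver.Ring.AlmostCommutativeRing using (fromCommutativeRing; _-Raw-AlmostCommutative⟶_)
import Relation.Binary.Reasoning.Setoid as ≈-Reasoning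

-- Integer coefficients let the solver cancel signs, which it cannot do with symbolic coefficients.
module IntegerCoefficientSolver {c ℓ : Level} (R : CommutativeRing c ℓ) where
  open CommutativeRing R
  open import Algebra.Properties.Ring ring
    using (-0#≈0#; -‿involutive; -‿+-comm; -‿distribˡ-*; -‿distribʳ-*)
  open import Algebra.Properties.CommutativeSemigroup +-commutativeSemigroup
    using () renaming (interchange to +-interchange)
  open import Algebra.Properties.CommutativeSemigroup *-commutativeSemigroup
    using () renaming (interchange to *-interchange)
  open import Algebra.Properties.Monoid.Mult.TCOptimised +-monoid using (_×_; 1+×; ×-homo-+)
  open import Algebra.Properties.Semiring.Mult.TCOptimised semiring using (×1-homo-*)
  open ≈-Reasoning setoid

  -- The optimised _×_ sends 1 to 1# itself, so solver constants match goals syntactically.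
  fromℤ : ℤ → Carrier
  fromℤ (+ n)    = n × 1#
  fromℤ -[1+ n ] = - (suc n × 1#)

  [x+y]-[x+z]≈y-z : ∀ x y z → (x + y) - (x + z) ≈ y - z
  [x+y]-[x+z]≈y-z x y z = begin
    (x + y) - (x + z)     ≈⟨ +-congˡ (-‿+-comm x z) ⟨
    (x + y) + (- x - z)   ≈⟨ +-interchange x y (- x) (- z) ⟩
    (x - x) + (y - z)     ≈⟨ +-congʳ (-‿inverseʳ x) ⟩
    0# + (y - z)          ≈⟨ +-identityˡ _ ⟩
    y - z                 ∎

  fromℤ-⊖ : ∀ m n → fromℤ (m ⊖ n) ≈ m × 1# - n × 1#
  fromℤ-⊖ zero    zero    = sym (-‿inverseʳ 0#)
  fromℤ-⊖ zero    (suc n) = sym (+-identityˡ _)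
  fromℤ-⊖ (suc m) zero    = sym (trans (+-congˡ -0#≈0#) (+-identityʳ _))
  fromℤ-⊖ (suc m) (suc n) = begin
    fromℤ (suc m ⊖ suc n)      ≡⟨ ≡.cong fromℤ (ℤ.[1+m]⊖[1+n]≡m⊖n m n) ⟩
    fromℤ (m ⊖ n)              ≈⟨ fromℤ-⊖ m n ⟩
    m × 1# - n × 1#            ≈⟨ [x+y]-[x+z]≈y-z 1# (m × 1#) (n × 1#) ⟨
    (1# + m × 1#) - (1# + n × 1#) ≈⟨ +-cong (1+× m 1#) (-‿cong (1+× n 1#)) ⟨
    suc m × 1# - suc n × 1#    ∎

  fromℤ-+ : ∀ i j → fromℤ (i ℤ.+ j) ≈ fromℤ i + fromℤ j
  fromℤ-+ (+ m)    (+ n)    = ×-homo-+ 1# m n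
  fromℤ-+ (+ m)    -[1+ n ] = fromℤ-⊖ m (suc n)
  fromℤ-+ -[1+ m ] (+ n)    = trans (fromℤ-⊖ n (suc m)) (+-comm _ _)
  fromℤ-+ -[1+ m ] -[1+ n ] = begin
    - (suc (suc (m ℕ.+ n)) × 1#)          ≡⟨ ≡.cong (λ k → - (suc k × 1#)) (ℕ.+-suc m n) ⟨
    - ((suc m ℕ.+ suc n) × 1#)            ≈⟨ -‿cong (×-homo-+ 1# (suc m) (suc n)) ⟩
    - (suc m × 1# + suc n × 1#)           ≈⟨ -‿+-comm _ _ ⟨
    - (suc m × 1#) - (suc n × 1#)         ∎

  fromℤ-neg : ∀ i → fromℤ (ℤ.- i) ≈ - fromℤ i
  fromℤ-neg (+ zero)  = sym -0#≈0#
  fromℤ-neg (+ suc n) = refl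
  fromℤ-neg -[1+ n ]  = sym (-‿involutive _)

  fromSign : Sign → Carrier
  fromSign Sign.+ = 1#
  fromSign Sign.- = - 1#

  fromSign-* : ∀ s t → fromSign (s Sign.* t) ≈ fromSign s * fromSign t
  fromSign-* Sign.+ t      = sym (*-identityˡ _)
  fromSign-* Sign.- Sign.+ = sym (*-identityʳ _)
  fromSign-* Sign.- Sign.- = begin
    1#            ≈⟨ -‿involutive 1# ⟨
    - - 1#        ≈⟨ -‿cong (*-identityʳ _) ⟨
    - (- 1# * 1#) ≈⟨ -‿distribʳ-* _ _ ⟩
    - 1# * - 1#   ∎

  fromℤ-◃ : ∀ s n → fromℤ (s ◃ n) ≈ fromSign s * (n × 1#)
  fromℤ-◃ s      zero    = sym (zeroʳ _)
  fromℤ-◃ Sign.+ (suc n) = sym (*-identityˡ _)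
  fromℤ-◃ Sign.- (suc n) = trans (-‿cong (sym (*-identityˡ _))) (-‿distribˡ-* _ _)

  fromℤ-signAbs : ∀ i → fromℤ i ≈ fromSign (ℤ.sign i) * (ℤ.∣ i ∣ × 1#)
  fromℤ-signAbs i = trans (reflexive (≡.cong fromℤ (≡.sym (ℤ.◃-inverse i)))) (fromℤ-◃ (ℤ.sign i) ℤ.∣ i ∣)

  fromℤ-* : ∀ i j → fromℤ (i ℤ.* j) ≈ fromℤ i * fromℤ j
  fromℤ-* i j = begin
    fromℤ (i ℤ.* j)
      ≈⟨ fromℤ-◃ (ℤ.sign i Sign.* ℤ.sign j) (ℤ.∣ i ∣ ℕ.* ℤ.∣ j ∣) ⟩
    fromSign (ℤ.sign i Sign.* ℤ.sign j) * ((ℤ.∣ i ∣ ℕ.* ℤ.∣ j ∣) × 1#)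
      ≈⟨ *-cong (fromSign-* (ℤ.sign i) (ℤ.sign j)) (×1-homo-* ℤ.∣ i ∣ ℤ.∣ j ∣) ⟩
    (fromSign (ℤ.sign i) * fromSign (ℤ.sign j)) * ((ℤ.∣ i ∣ × 1#) * (ℤ.∣ j ∣ × 1#))
      ≈⟨ *-interchange _ _ _ _ ⟩
    (fromSign (ℤ.sign i) * (ℤ.∣ i ∣ × 1#)) * (fromSign (ℤ.sign j) * (ℤ.∣ j ∣ × 1#))
      ≈⟨ *-cong (fromℤ-signAbs i) (fromℤ-signAbs j) ⟨
    fromℤ i * fromℤ j
      ∎

  fromℤ-homomorphism : ℤ.+-*-rawRing -Raw-AlmostCommutative⟶ fromCommutativeRing R
  fromℤ-homomorphism = record
    { ⟦_⟧    = fromℤ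
    ; +-homo = fromℤ-+
    ; *-homo = fromℤ-*
    ; -‿homo = fromℤ-neg
    ; 0-homo = refl
    ; 1-homo = refl
    }

  fromℤ-≟ : ∀ i j → Maybe (fromℤ i ≈ fromℤ j)
  fromℤ-≟ i j with i ℤ.≟ j
  ... | yes ≡.refl = just refl
  ... | no  _      = nothing

  open import Algebra.Solver.Ring ℤ.+-*-rawRing (fromCommutativeRing R) fromℤ-homomorphism fromℤ-≟ public

module Eulerian {c ℓ : Level} (R : CommutativeRing c ℓ) where
  open CommutativeRing R
  open RingOps R
  open IntegerCoefficientSolver R
    using (solve; _:=_; _:+_; _:*_; _:-_; :-_; con)
  open import Algebra.Properties.Ring ring using (-‿distribˡ-*; [y-z]x≈yx-zx)
  open ≈-Reasoning setoid

  fromℕ-+ : ∀ m n → fromℕ (m ℕ.+ n) ≈ fromℕ m + fromℕ n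
  fromℕ-+ zero    n = sym (+-identityˡ _)
  fromℕ-+ (suc m) n = trans (+-congˡ (fromℕ-+ m n)) (sym (+-assoc _ _ _))

  fromℕ-* : ∀ m n → fromℕ (m ℕ.* n) ≈ fromℕ m * fromℕ n
  fromℕ-* zero    n = sym (zeroˡ _)
  fromℕ-* (suc m) n = trans (fromℕ-+ n (m ℕ.* n)) (trans (+-congˡ (fromℕ-* m n))
    (solve 2 (λ x y → y :+ x :* y := (con (+ 1) :+ x) :* y) refl (fromℕ m) (fromℕ n)))

  sumTo-cong : ∀ n {f g : ℕ → Carrier} → (∀ i → f i ≈ g i) → sumTo n f ≈ sumTo n g
  sumTo-cong zero    f≈g = f≈g 0
  sumTo-cong (suc n) f≈g = +-cong (sumTo-cong n f≈g) (f≈g (suc n))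

  sumTo-cong-≤ : ∀ n {f g : ℕ → Carrier} → (∀ i → i ≤ n → f i ≈ g i) → sumTo n f ≈ sumTo n g
  sumTo-cong-≤ zero    f≈g = f≈g 0 z≤n
  sumTo-cong-≤ (suc n) f≈g =
    +-cong (sumTo-cong-≤ n (λ i i≤n → f≈g i (ℕ.m≤n⇒m≤1+n i≤n))) (f≈g (suc n) ℕ.≤-refl)

  sumTo-distrib-+ : ∀ n (f g : ℕ → Carrier) → sumTo n (λ i → f i + g i) ≈ sumTo n f + sumTo n g
  sumTo-distrib-+ zero    f g = refl
  sumTo-distrib-+ (suc n) f g = trans (+-congʳ (sumTo-distrib-+ n f g))
    (solve 4 (λ a b x y → (a :+ b) :+ (x :+ y) := (a :+ x) :+ (b :+ y)) refl
      (sumTo n f) (sumTo n g) (f (suc n)) (g (suc n)))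

  sumTo-distrib-- : ∀ n (f g : ℕ → Carrier) → sumTo n (λ i → f i - g i) ≈ sumTo n f - sumTo n g
  sumTo-distrib-- zero    f g = refl
  sumTo-distrib-- (suc n) f g = trans (+-congʳ (sumTo-distrib-- n f g))
    (solve 4 (λ a b x y → (a :- b) :+ (x :- y) := (a :+ x) :- (b :+ y)) refl
      (sumTo n f) (sumTo n g) (f (suc n)) (g (suc n)))

  *-distribˡ-sumTo : ∀ n a (f : ℕ → Carrier) → a * sumTo n f ≈ sumTo n (λ i → a * f i)
  *-distribˡ-sumTo zero    a f = refl
  *-distribˡ-sumTo (suc n) a f = trans (distribˡ _ _ _) (+-congʳ (*-distribˡ-sumTo n a f))

  *-distribʳ-sumTo : ∀ n a (f : ℕ → Carrier) → sumTo n f * a ≈ sumTo n (λ i → f i * a)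
  *-distribʳ-sumTo zero    a f = refl
  *-distribʳ-sumTo (suc n) a f = trans (distribʳ _ _ _) (+-congʳ (*-distribʳ-sumTo n a f))

  sumTo-zero : ∀ n (f : ℕ → Carrier) → (∀ i → i ≤ n → f i ≈ 0#) → sumTo n f ≈ 0#
  sumTo-zero n f f≈0 = trans (sumTo-cong-≤ n f≈0) (sumTo-const-0 n)
    where
    sumTo-const-0 : ∀ n → sumTo n (λ _ → 0#) ≈ 0#
    sumTo-const-0 zero    = refl
    sumTo-const-0 (suc n) = trans (+-congʳ (sumTo-const-0 n)) (+-identityʳ 0#)

  sumTo-suc-head : ∀ n (f : ℕ → Carrier) → sumTo (suc n) f ≈ f 0 + sumTo n (λ i → f (suc i))
  sumTo-suc-head zero    f = refl
  sumTo-suc-head (suc n) f = trans (+-congʳ (sumTo-suc-head n f)) (+-assoc _ _ _)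

  sumTo-comm : ∀ m n (f : ℕ → ℕ → Carrier) →
    sumTo m (λ i → sumTo n (λ j → f i j)) ≈ sumTo n (λ j → sumTo m (λ i → f i j))
  sumTo-comm zero    n f = refl
  sumTo-comm (suc m) n f = trans (+-congʳ (sumTo-comm m n f)) (sym (sumTo-distrib-+ n _ _))

  sumTo-single : ∀ n k (f : ℕ → Carrier) → k ≤ n →
    (∀ i → i ≤ n → i ≢ k → f i ≈ 0#) → sumTo n f ≈ f k
  sumTo-single zero    zero f _   _    = refl
  sumTo-single (suc n) k    f k≤n f≈0 with k ℕ.≟ suc n
  ... | yes ≡.refl = trans (+-congʳ (sumTo-zero n f (λ i i≤n → f≈0 i (ℕ.m≤n⇒m≤1+n i≤n) (ℕ.<⇒≢ (s≤s i≤n)))))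
                           (+-identityˡ _)
  ... | no  k≢1+n  = trans (+-cong (sumTo-single n k f (ℕ.≤-pred (ℕ.≤∧≢⇒< k≤n k≢1+n))
                                     (λ i i≤n → f≈0 i (ℕ.m≤n⇒m≤1+n i≤n)))
                                   (f≈0 (suc n) ℕ.≤-refl (k≢1+n ∘ ≡.sym)))
                           (+-identityʳ _)

  tail : Series → Series
  tail f i = f (suc i)

  ⊛-cong : ∀ {f f′ g g′ : Series} → (∀ i → f i ≈ f′ i) → (∀ i → g i ≈ g′ i) →
    ∀ m → (f ⊛ g) m ≈ (f′ ⊛ g′) m
  ⊛-cong f≈f′ g≈g′ m = sumTo-cong m (λ i → *-cong (f≈f′ i) (g≈g′ (m ∸ i)))

  ⊛-suc : ∀ (f g : Series) m → (f ⊛ g) (suc m) ≈ f 0 * g (suc m) + (tail f ⊛ g) m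
  ⊛-suc f g m = sumTo-suc-head m (λ i → f i * g (suc m ∸ i))

  ⊛-linearˡ : ∀ a (u v h : Series) m →
    ((λ i → a * u i + v i) ⊛ h) m ≈ a * (u ⊛ h) m + (v ⊛ h) m
  ⊛-linearˡ a u v h m = begin
    sumTo m (λ i → (a * u i + v i) * h (m ∸ i))
      ≈⟨ sumTo-cong m (λ i → trans (distribʳ _ _ _) (+-congʳ (*-assoc _ _ _))) ⟩
    sumTo m (λ i → a * (u i * h (m ∸ i)) + v i * h (m ∸ i))
      ≈⟨ sumTo-distrib-+ m _ _ ⟩
    sumTo m (λ i → a * (u i * h (m ∸ i))) + (v ⊛ h) m
      ≈⟨ +-congʳ (*-distribˡ-sumTo m a _) ⟨
    a * (u ⊛ h) m + (v ⊛ h) m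
      ∎

  ⊛-*ʳ : ∀ a (f g : Series) m → (f ⊛ (λ i → a * g i)) m ≈ a * (f ⊛ g) m
  ⊛-*ʳ a f g m = begin
    sumTo m (λ i → f i * (a * g (m ∸ i)))
      ≈⟨ sumTo-cong m (λ i → solve 3 (λ x y z → x :* (y :* z) := y :* (x :* z)) refl (f i) a (g (m ∸ i))) ⟩
    sumTo m (λ i → a * (f i * g (m ∸ i)))
      ≈⟨ *-distribˡ-sumTo m a _ ⟨
    a * (f ⊛ g) m
      ∎

  ⊛-sumToʳ : ∀ n (f : Series) (g : ℕ → Series) m →
    (f ⊛ (λ i → sumTo n (λ k → g k i))) m ≈ sumTo n (λ k → (f ⊛ g k) m)
  ⊛-sumToʳ n f g m = trans (sumTo-cong m (λ i → *-distribˡ-sumTo n (f i) _)) (sumTo-comm m n _)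

  ⊛-assoc : ∀ (f g h : Series) m → ((f ⊛ g) ⊛ h) m ≈ (f ⊛ (g ⊛ h)) m
  ⊛-assoc f g h zero    = *-assoc _ _ _
  ⊛-assoc f g h (suc m) = begin
    ((f ⊛ g) ⊛ h) (suc m)
      ≈⟨ ⊛-suc (f ⊛ g) h m ⟩
    (f 0 * g 0) * h (suc m) + (tail (f ⊛ g) ⊛ h) m
      ≈⟨ +-congˡ (⊛-cong {g = h} (⊛-suc f g) (λ _ → refl) m) ⟩
    (f 0 * g 0) * h (suc m) + ((λ i → f 0 * g (suc i) + (tail f ⊛ g) i) ⊛ h) m
      ≈⟨ +-congˡ (⊛-linearˡ (f 0) (tail g) (tail f ⊛ g) h m) ⟩
    (f 0 * g 0) * h (suc m) + (f 0 * (tail g ⊛ h) m + ((tail f ⊛ g) ⊛ h) m)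
      ≈⟨ +-congˡ (+-congˡ (⊛-assoc (tail f) g h m)) ⟩
    (f 0 * g 0) * h (suc m) + (f 0 * (tail g ⊛ h) m + (tail f ⊛ (g ⊛ h)) m)
      ≈⟨ solve 5 (λ a b c x y → (a :* b) :* c :+ (a :* x :+ y) := a :* (b :* c :+ x) :+ y) refl
           (f 0) (g 0) (h (suc m)) ((tail g ⊛ h) m) ((tail f ⊛ (g ⊛ h)) m) ⟩
    f 0 * (g 0 * h (suc m) + (tail g ⊛ h) m) + (tail f ⊛ (g ⊛ h)) m
      ≈⟨ +-congʳ (*-congˡ (⊛-suc g h m)) ⟨
    f 0 * (g ⊛ h) (suc m) + (tail f ⊛ (g ⊛ h)) m
      ≈⟨ ⊛-suc f (g ⊛ h) m ⟨
    (f ⊛ (g ⊛ h)) (suc m)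
      ∎

  ⊛-zeroˡ : ∀ (h : Series) m → ((λ _ → 0#) ⊛ h) m ≈ 0#
  ⊛-zeroˡ h m = sumTo-zero m _ (λ i _ → zeroˡ _)

  ⊛-identityˡ : ∀ (h : Series) m → (one ⊛ h) m ≈ h m
  ⊛-identityˡ h zero    = *-identityˡ _
  ⊛-identityˡ h (suc m) = trans (⊛-suc one h m) (trans (+-cong (*-identityˡ _) (⊛-zeroˡ h m)) (+-identityʳ _))

  ⊛-identityʳ : ∀ (f : Series) m → (f ⊛ one) m ≈ f m
  ⊛-identityʳ f zero    = *-identityʳ _
  ⊛-identityʳ f (suc m) = trans (⊛-suc f one m) (trans (+-cong (zeroʳ _) (⊛-identityʳ (tail f) m)) (+-identityˡ _))

  ⊛-oneMinusX-suc : ∀ (f : Series) m → (f ⊛ oneMinusX) (suc m) ≈ f (suc m) - f m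
  ⊛-oneMinusX-suc f zero    = solve 2 (λ a b → a :* (:- con (+ 1)) :+ b :* con (+ 1) := b :- a) refl (f 0) (f 1)
  ⊛-oneMinusX-suc f (suc m) = trans (⊛-suc f oneMinusX (suc m))
    (trans (+-cong (zeroʳ _) (⊛-oneMinusX-suc (tail f) m)) (+-identityˡ _))

  Δ : Series → Series
  Δ h = oneMinusX ⊛ h

  Δ-suc : ∀ (h : Series) m → Δ h (suc m) ≈ h (suc m) - h m
  Δ-suc h m = trans (⊛-suc oneMinusX h m) (+-cong (*-identityˡ _) (tail-oneMinusX-⊛ m))
    where
    tail-oneMinusX-⊛ : ∀ m → (tail oneMinusX ⊛ h) m ≈ - h m
    tail-oneMinusX-⊛ zero    = solve 1 (λ a → (:- con (+ 1)) :* a := :- a) refl (h 0)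
    tail-oneMinusX-⊛ (suc m) = trans (⊛-suc (tail oneMinusX) h m)
      (trans (+-congˡ (⊛-zeroˡ h m)) (solve 1 (λ a → (:- con (+ 1)) :* a :+ con (+ 0) := :- a) refl (h (suc m))))

  Δ^ : ℕ → Series → Series
  Δ^ zero    h = h
  Δ^ (suc n) h = Δ^ n (Δ h)

  Δ^-cong : ∀ n {h h′ : Series} → (∀ i → h i ≈ h′ i) → ∀ i → Δ^ n h i ≈ Δ^ n h′ i
  Δ^-cong zero    h≈h′ = h≈h′
  Δ^-cong (suc n) h≈h′ = Δ^-cong n (⊛-cong {f = oneMinusX} (λ _ → refl) h≈h′)

  Δ^-* : ∀ n a (h : Series) i → Δ^ n (λ m → a * h m) i ≈ a * Δ^ n h i
  Δ^-* zero    a h i = refl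
  Δ^-* (suc n) a h i = trans (Δ^-cong n (⊛-*ʳ a oneMinusX h) i) (Δ^-* n a (Δ h) i)

  Δ^-+ : ∀ a b (h : Series) → Δ^ (a ℕ.+ b) h ≡ Δ^ b (Δ^ a h)
  Δ^-+ zero    b h = ≡.refl
  Δ^-+ (suc a) b h = Δ^-+ a b (Δ h)

  oneMinusX^ : ℕ → Series
  oneMinusX^ = seriesPow oneMinusX

  oneMinusX^-⊛ : ∀ n (h : Series) m → (oneMinusX^ n ⊛ h) m ≈ Δ^ n h m
  oneMinusX^-⊛ zero    h m = ⊛-identityˡ h m
  oneMinusX^-⊛ (suc n) h m = trans (⊛-assoc (oneMinusX^ n) oneMinusX h m) (oneMinusX^-⊛ n (Δ h) m)

  -- Rising factorials: degFall (- 1#) x k = x (x + 1) ⋯ (x + k - 1)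
  rising-suc : ∀ x k → degFall (- 1#) x (suc k) ≈ x * degFall (- 1#) (1# + x) k
  rising-suc x zero    =
    solve 1 (λ x → con (+ 1) :* (x :- con (+ 0) :* (:- con (+ 1))) := x :* con (+ 1)) refl x
  rising-suc x (suc k) = begin
    degFall (- 1#) x (suc k) * (x - (1# + fromℕ k) * - 1#)
      ≈⟨ *-congʳ (rising-suc x k) ⟩
    (x * degFall (- 1#) (1# + x) k) * (x - (1# + fromℕ k) * - 1#)
      ≈⟨ solve 3 (λ x d t → (x :* d) :* (x :- (con (+ 1) :+ t) :* (:- con (+ 1)))
                         := x :* (d :* ((con (+ 1) :+ x) :- t :* (:- con (+ 1))))) refl
           x (degFall (- 1#) (1# + x) k) (fromℕ k) ⟩
    x * (degFall (- 1#) (1# + x) k * ((1# + x) - fromℕ k * - 1#))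
      ∎

  Δ-rising-zero : ∀ m → Δ (degGen (- 1#) 0) m ≈ one m
  Δ-rising-zero zero    = *-identityˡ _
  Δ-rising-zero (suc m) = trans (Δ-suc (degGen (- 1#) 0) m) (-‿inverseʳ 1#)

  Δ-rising-suc : ∀ k m → Δ (degGen (- 1#) (suc k)) m ≈ fromℕ (suc k) * degGen (- 1#) k m
  Δ-rising-suc k zero    = trans (*-identityˡ _)
    (solve 2 (λ d t → d :* (con (+ 1) :+ con (+ 0) :- t :* (:- con (+ 1))) := (con (+ 1) :+ t) :* d) refl
      (degGen (- 1#) k 0) (fromℕ k))
  Δ-rising-suc k (suc m) = begin
    Δ (degGen (- 1#) (suc k)) (suc m)
      ≈⟨ Δ-suc (degGen (- 1#) (suc k)) m ⟩
    degGen (- 1#) (suc k) (suc m) - degGen (- 1#) (suc k) m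
      ≈⟨ +-congˡ (-‿cong (rising-suc (fromℕ (suc m)) k)) ⟩
    d * (fromℕ (suc (suc m)) - fromℕ k * - 1#) - fromℕ (suc m) * d
      ≈⟨ solve 3 (λ d x t → d :* ((con (+ 1) :+ x) :- t :* (:- con (+ 1))) :- x :* d := (con (+ 1) :+ t) :* d) refl
           d (fromℕ (suc m)) (fromℕ k) ⟩
    fromℕ (suc k) * d
      ∎
    where
    d : Carrier
    d = degGen (- 1#) k (suc m)

  Δ^-rising : ∀ k m → Δ^ (suc k) (degGen (- 1#) k) m ≈ fromℕ (k !) * one m
  Δ^-rising zero    m = trans (Δ-rising-zero m) (trans (sym (*-identityˡ _)) (*-congʳ (sym (+-identityʳ 1#))))
  Δ^-rising (suc k) m = begin
    Δ^ (suc k) (Δ (degGen (- 1#) (suc k))) m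
      ≈⟨ Δ^-cong (suc k) (Δ-rising-suc k) m ⟩
    Δ^ (suc k) (λ i → fromℕ (suc k) * degGen (- 1#) k i) m
      ≈⟨ Δ^-* (suc k) _ (degGen (- 1#) k) m ⟩
    fromℕ (suc k) * Δ^ (suc k) (degGen (- 1#) k) m
      ≈⟨ *-congˡ (Δ^-rising k m) ⟩
    fromℕ (suc k) * (fromℕ (k !) * one m)
      ≈⟨ *-assoc _ _ _ ⟨
    (fromℕ (suc k) * fromℕ (k !)) * one m
      ≈⟨ *-congʳ (fromℕ-* (suc k) (k !)) ⟨
    fromℕ (suc k !) * one m
      ∎

  oneMinusX^-⊛-rising : ∀ n k → k ≤ n → ∀ m →
    (oneMinusX^ (suc n) ⊛ degGen (- 1#) k) m ≈ fromℕ (k !) * oneMinusX^ (n ∸ k) m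
  oneMinusX^-⊛-rising n k k≤n m = begin
    (oneMinusX^ (suc n) ⊛ degGen (- 1#) k) m
      ≈⟨ oneMinusX^-⊛ (suc n) (degGen (- 1#) k) m ⟩
    Δ^ (suc n) (degGen (- 1#) k) m
      ≡⟨ ≡.cong (λ e → Δ^ (suc e) (degGen (- 1#) k) m) (ℕ.m+[n∸m]≡n k≤n) ⟨
    Δ^ (suc k ℕ.+ (n ∸ k)) (degGen (- 1#) k) m
      ≡⟨ ≡.cong (λ h → h m) (Δ^-+ (suc k) (n ∸ k) (degGen (- 1#) k)) ⟩
    Δ^ (n ∸ k) (Δ^ (suc k) (degGen (- 1#) k)) m
      ≈⟨ Δ^-cong (n ∸ k) (Δ^-rising k) m ⟩
    Δ^ (n ∸ k) (λ i → fromℕ (k !) * one i) m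
      ≈⟨ Δ^-* (n ∸ k) _ one m ⟩
    fromℕ (k !) * Δ^ (n ∸ k) one m
      ≈⟨ *-congˡ (oneMinusX^-⊛ (n ∸ k) one m) ⟨
    fromℕ (k !) * (oneMinusX^ (n ∸ k) ⊛ one) m
      ≈⟨ *-congˡ (⊛-identityʳ (oneMinusX^ (n ∸ k)) m) ⟩
    fromℕ (k !) * oneMinusX^ (n ∸ k) m
      ∎

  -- For a polynomial f of degree ≤ M, the coefficient of yʳ in f (1 + y).
  binomialMoment : ℕ → Series → ℕ → Carrier
  binomialMoment M f r = sumTo M (λ j → f j * fromℕ (j C r))

  binomialMoment-⊛oneMinusX : ∀ M (f : Series) r →
    binomialMoment (suc M) (f ⊛ oneMinusX) r
      ≈ binomialMoment (suc M) f r - sumTo M (λ j → f j * fromℕ (suc j C r))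
  binomialMoment-⊛oneMinusX M f r = begin
    binomialMoment (suc M) (f ⊛ oneMinusX) r
      ≈⟨ sumTo-suc-head M _ ⟩
    (f ⊛ oneMinusX) 0 * fromℕ (0 C r) + sumTo M (λ j → (f ⊛ oneMinusX) (suc j) * b j)
      ≈⟨ +-cong (*-congʳ (*-identityʳ _)) (sumTo-cong M (λ j → trans (*-congʳ (⊛-oneMinusX-suc f j))
           ([y-z]x≈yx-zx (b j) (f (suc j)) (f j)))) ⟩
    f 0 * fromℕ (0 C r) + sumTo M (λ j → f (suc j) * b j - f j * b j)
      ≈⟨ +-congˡ (sumTo-distrib-- M _ _) ⟩
    f 0 * fromℕ (0 C r) + (sumTo M (λ j → f (suc j) * b j) - sumTo M (λ j → f j * b j))
      ≈⟨ +-assoc _ _ _ ⟨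
    (f 0 * fromℕ (0 C r) + sumTo M (λ j → f (suc j) * b j)) - sumTo M (λ j → f j * b j)
      ≈⟨ +-congʳ (sumTo-suc-head M _) ⟨
    binomialMoment (suc M) f r - sumTo M (λ j → f j * fromℕ (suc j C r))
      ∎
    where
    b : ℕ → Carrier
    b j = fromℕ (suc j C r)

  binomialMoment-pascal : ∀ M (f : Series) r →
    sumTo M (λ j → f j * fromℕ (suc j C suc r)) ≈ binomialMoment M f r + binomialMoment M f (suc r)
  binomialMoment-pascal M f r = trans (sumTo-cong M pascal) (sumTo-distrib-+ M _ _)
    where
    pascal : ∀ j → f j * fromℕ (suc j C suc r) ≈ f j * fromℕ (j C r) + f j * fromℕ (j C suc r)
    pascal j = begin
      f j * fromℕ (suc j C suc r)                 ≡⟨ ≡.cong (λ e → f j * fromℕ e) (nCk+nC[k+1]≡[n+1]C[k+1] j r) ⟨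
      f j * fromℕ (j C r ℕ.+ j C suc r)           ≈⟨ *-congˡ (fromℕ-+ (j C r) (j C suc r)) ⟩
      f j * (fromℕ (j C r) + fromℕ (j C suc r))   ≈⟨ distribˡ _ _ _ ⟩
      f j * fromℕ (j C r) + f j * fromℕ (j C suc r) ∎

  kronecker : ℕ → ℕ → Carrier
  kronecker zero    zero    = 1#
  kronecker zero    (suc _) = 0#
  kronecker (suc _) zero    = 0#
  kronecker (suc m) (suc n) = kronecker m n

  kronecker-refl : ∀ n → kronecker n n ≡ 1#
  kronecker-refl zero    = ≡.refl
  kronecker-refl (suc n) = kronecker-refl n

  kronecker-≢ : ∀ m n → m ≢ n → kronecker m n ≡ 0#
  kronecker-≢ zero    zero    m≢n = contradiction ≡.refl m≢n
  kronecker-≢ zero    (suc n) _   = ≡.refl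
  kronecker-≢ (suc m) zero    _   = ≡.refl
  kronecker-≢ (suc m) (suc n) m≢n = kronecker-≢ m n (m≢n ∘ ≡.cong suc)

  binomialMoment-one : ∀ M r → binomialMoment M one r ≈ kronecker 0 r * sign 0
  binomialMoment-one zero    zero    = *-congˡ (+-identityʳ 1#)
  binomialMoment-one zero    (suc r) = *-comm 1# 0#
  binomialMoment-one (suc M) r       = trans (+-cong (binomialMoment-one M r) (zeroˡ _)) (+-identityʳ _)

  binomialMoment-oneMinusX^ : ∀ N M r → N ≤ M → binomialMoment M (oneMinusX^ N) r ≈ kronecker N r * sign N
  binomialMoment-oneMinusX^ zero    M       r _           = binomialMoment-one M r
  binomialMoment-oneMinusX^ (suc N) (suc M) r (s≤s N≤M) = begin
    binomialMoment (suc M) (oneMinusX^ N ⊛ oneMinusX) r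
      ≈⟨ binomialMoment-⊛oneMinusX M (oneMinusX^ N) r ⟩
    binomialMoment (suc M) (oneMinusX^ N) r - shifted r
      ≈⟨ +-congʳ (binomialMoment-oneMinusX^ N (suc M) r (ℕ.m≤n⇒m≤1+n N≤M)) ⟩
    kronecker N r * sign N - shifted r
      ≈⟨ step r ⟩
    kronecker (suc N) r * sign (suc N)
      ∎
    where
    shifted : ℕ → Carrier
    shifted r = sumTo M (λ j → oneMinusX^ N j * fromℕ (suc j C r))

    IH : ∀ r → binomialMoment M (oneMinusX^ N) r ≈ kronecker N r * sign N
    IH r = binomialMoment-oneMinusX^ N M r N≤M

    step : ∀ r → kronecker N r * sign N - shifted r ≈ kronecker (suc N) r * - sign N
    step zero    = trans (+-congˡ (-‿cong (IH 0)))
      (solve 2 (λ d s → d :* s :- d :* s := con (+ 0) :* (:- s)) refl (kronecker N 0) (sign N))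
    step (suc r) = begin
      kronecker N (suc r) * sign N - shifted (suc r)
        ≈⟨ +-congˡ (-‿cong (trans (binomialMoment-pascal M (oneMinusX^ N) r) (+-cong (IH r) (IH (suc r))))) ⟩
      kronecker N (suc r) * sign N - (kronecker N r * sign N + kronecker N (suc r) * sign N)
        ≈⟨ solve 3 (λ a b s → a :* s :- (b :* s :+ a :* s) := b :* (:- s)) refl
             (kronecker N (suc r)) (kronecker N r) (sign N) ⟩
      kronecker N r * - sign N
        ∎

  binomialMoment-combination : ∀ n k (a : ℕ → Carrier) (g : Series) → k ≤ n →
    (∀ j → g j ≈ sumTo n (λ i → a i * oneMinusX^ (n ∸ i) j)) →
    binomialMoment n g (n ∸ k) ≈ a k * sign (n ∸ k)
  binomialMoment-combination n k a g k≤n g≈ = begin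
    sumTo n (λ j → g j * fromℕ (j C (n ∸ k)))
      ≈⟨ sumTo-cong n (λ j → trans (*-congʳ (g≈ j)) (trans (*-distribʳ-sumTo n _ _)
           (sumTo-cong n (λ i → *-assoc _ _ _)))) ⟩
    sumTo n (λ j → sumTo n (λ i → a i * (oneMinusX^ (n ∸ i) j * fromℕ (j C (n ∸ k)))))
      ≈⟨ sumTo-comm n n _ ⟩
    sumTo n (λ i → sumTo n (λ j → a i * (oneMinusX^ (n ∸ i) j * fromℕ (j C (n ∸ k)))))
      ≈⟨ sumTo-cong n (λ i → *-distribˡ-sumTo n (a i) _) ⟨
    sumTo n (λ i → a i * binomialMoment n (oneMinusX^ (n ∸ i)) (n ∸ k))
      ≈⟨ sumTo-cong n (λ i → *-congˡ (binomialMoment-oneMinusX^ (n ∸ i) n (n ∸ k) (ℕ.m∸n≤m n i))) ⟩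
    sumTo n (λ i → a i * (kronecker (n ∸ i) (n ∸ k) * sign (n ∸ i)))
      ≈⟨ sumTo-single n k _ k≤n (λ i i≤n i≢k → trans (*-congˡ (trans (*-congʳ (reflexive
           (kronecker-≢ (n ∸ i) (n ∸ k) (i≢k ∘ ℕ.∸-cancelˡ-≡ i≤n k≤n)))) (zeroˡ _))) (zeroʳ _)) ⟩
    a k * (kronecker (n ∸ k) (n ∸ k) * sign (n ∸ k))
      ≈⟨ *-congˡ (trans (*-congʳ (reflexive (kronecker-refl (n ∸ k)))) (*-identityˡ _)) ⟩
    a k * sign (n ∸ k)
      ∎

  sign-+ : ∀ m n → sign (m ℕ.+ n) ≈ sign m * sign n
  sign-+ zero    n = sym (*-identityˡ _)
  sign-+ (suc m) n = trans (-‿cong (sign-+ m n)) (-‿distribˡ-* _ _)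

  sign-square : ∀ n → sign n * sign n ≈ 1#
  sign-square zero    = *-identityˡ _
  sign-square (suc n) = trans (solve 1 (λ s → (:- s) :* (:- s) := s :* s) refl (sign n)) (sign-square n)

  sign-∸ : ∀ {i n} → i ≤ n → sign n * sign i ≈ sign (n ∸ i)
  sign-∸ {i} {n} i≤n = begin
    sign n * sign i                   ≡⟨ ≡.cong (λ e → sign e * sign i) (ℕ.m+[n∸m]≡n i≤n) ⟨
    sign (i ℕ.+ (n ∸ i)) * sign i     ≈⟨ *-congʳ (sign-+ i (n ∸ i)) ⟩
    (sign i * sign (n ∸ i)) * sign i  ≈⟨ solve 2 (λ a b → (a :* b) :* a := (a :* a) :* b) refl (sign i) (sign (n ∸ i)) ⟩
    (sign i * sign i) * sign (n ∸ i)  ≈⟨ *-congʳ (sign-square i) ⟩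
    1# * sign (n ∸ i)                 ≈⟨ *-identityˡ _ ⟩
    sign (n ∸ i)                      ∎

  degFall-neg : ∀ μ x n → degFall (- μ) x n ≈ sign n * degFall μ (- x) n
  degFall-neg μ x zero    = sym (*-identityˡ _)
  degFall-neg μ x (suc n) = trans (*-congʳ (degFall-neg μ x n))
    (solve 5 (λ s d x t m → (s :* d) :* (x :- t :* (:- m)) := (:- s) :* (d :* ((:- x) :- t :* m))) refl
      (sign n) (degFall μ (- x) n) x (fromℕ n) μ)

  fall-neg : ∀ x k → fall (- x) k ≈ sign k * degFall (- 1#) x k
  fall-neg x k = begin
    fall (- x) k                        ≈⟨ *-identityˡ _ ⟨
    1# * fall (- x) k                   ≈⟨ *-congʳ (sign-square k) ⟨
    (sign k * sign k) * fall (- x) k    ≈⟨ *-assoc _ _ _ ⟩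
    sign k * (sign k * fall (- x) k)    ≈⟨ *-congˡ (degFall-neg 1# x k) ⟨
    sign k * degFall (- 1#) x k         ∎

  module _ (λ' : Carrier) (n : ℕ) (s : ℕ → Carrier)
           (s-expands : ∀ x → degFall λ' x n ≈ sumTo n (λ k → s k * fall x k)) where

    signed : ℕ → Carrier
    signed i = sign (n ∸ i) * s i

    degGen-expansion : ∀ m → degGen (- λ') n m ≈ sumTo n (λ i → signed i * degGen (- 1#) i m)
    degGen-expansion m = begin
      degFall (- λ') x n                              ≈⟨ degFall-neg λ' x n ⟩
      sign n * degFall λ' (- x) n                     ≈⟨ *-congˡ (s-expands (- x)) ⟩
      sign n * sumTo n (λ i → s i * fall (- x) i)     ≈⟨ *-distribˡ-sumTo n _ _ ⟩
      sumTo n (λ i → sign n * (s i * fall (- x) i))   ≈⟨ sumTo-cong-≤ n term ⟩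
      sumTo n (λ i → signed i * degFall (- 1#) x i)   ∎
      where
      x : Carrier
      x = fromℕ (suc m)

      term : ∀ i → i ≤ n → sign n * (s i * fall (- x) i) ≈ signed i * degFall (- 1#) x i
      term i i≤n = begin
        sign n * (s i * fall (- x) i)
          ≈⟨ *-congˡ (*-congˡ (fall-neg x i)) ⟩
        sign n * (s i * (sign i * degFall (- 1#) x i))
          ≈⟨ solve 4 (λ a b c d → a :* (b :* (c :* d)) := ((a :* c) :* b) :* d) refl
               (sign n) (s i) (sign i) (degFall (- 1#) x i) ⟩
        ((sign n * sign i) * s i) * degFall (- 1#) x i
          ≈⟨ *-congʳ (*-congʳ (sign-∸ i≤n)) ⟩
        signed i * degFall (- 1#) x i
          ∎

    degEulerian-expansion : ∀ j →
      degEulerian (- λ') n j ≈ sumTo n (λ i → (signed i * fromℕ (i !)) * oneMinusX^ (n ∸ i) j)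
    degEulerian-expansion j = begin
      (oneMinusX^ (suc n) ⊛ degGen (- λ') n) j
        ≈⟨ ⊛-cong {f = oneMinusX^ (suc n)} (λ _ → refl) degGen-expansion j ⟩
      (oneMinusX^ (suc n) ⊛ (λ m → sumTo n (λ i → signed i * degGen (- 1#) i m))) j
        ≈⟨ ⊛-sumToʳ n (oneMinusX^ (suc n)) (λ i m → signed i * degGen (- 1#) i m) j ⟩
      sumTo n (λ i → (oneMinusX^ (suc n) ⊛ (λ m → signed i * degGen (- 1#) i m)) j)
        ≈⟨ sumTo-cong n (λ i → ⊛-*ʳ (signed i) (oneMinusX^ (suc n)) (degGen (- 1#) i) j) ⟩
      sumTo n (λ i → signed i * (oneMinusX^ (suc n) ⊛ degGen (- 1#) i) j)
        ≈⟨ sumTo-cong-≤ n (λ i i≤n → trans (*-congˡ (oneMinusX^-⊛-rising n i i≤n j)) (sym (*-assoc _ _ _))) ⟩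
      sumTo n (λ i → (signed i * fromℕ (i !)) * oneMinusX^ (n ∸ i) j)
        ∎

    binomialMoment-degEulerian : ∀ k → k ≤ n →
      binomialMoment n (degEulerian (- λ') n) (n ∸ k) ≈ fromℕ (k !) * s k
    binomialMoment-degEulerian k k≤n = begin
      binomialMoment n (degEulerian (- λ') n) (n ∸ k)
        ≈⟨ binomialMoment-combination n k _ _ k≤n degEulerian-expansion ⟩
      ((sign (n ∸ k) * s k) * fromℕ (k !)) * sign (n ∸ k)
        ≈⟨ solve 3 (λ e a f → ((e :* a) :* f) :* e := (f :* a) :* (e :* e)) refl (sign (n ∸ k)) (s k) (fromℕ (k !)) ⟩
      (fromℕ (k !) * s k) * (sign (n ∸ k) * sign (n ∸ k))
        ≈⟨ *-congˡ (sign-square (n ∸ k)) ⟩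
      (fromℕ (k !) * s k) * 1#
        ≈⟨ *-identityʳ _ ⟩
      fromℕ (k !) * s k
        ∎

theorem2p8 : {c ℓ : Level} (F : CharZeroField c ℓ) →
    let open CharZeroField F in
    (λ' : Carrier) → ¬ (λ' ≈ 0#) →
    (S : ℕ → ℕ → Carrier) →
    ((n : ℕ) (x : Carrier) → degFall λ' x n ≈ sumTo n (λ k → S n k * fall x k)) →
    (n k : ℕ) → k ≤ n →
    S n k ≈ invFactorial k * sumTo n (λ j → degEulerian (- λ') n j * fromℕ (j C (n ∸ k)))
theorem2p8 F λ' _ S expand n k k≤n = begin
  S n k                                          ≈⟨ *-identityˡ _ ⟨
  1# * S n k                                     ≈⟨ *-congʳ (trans (*-comm _ _) (inverseʳ _ _)) ⟨
  (invFactorial k * fromℕ (k !)) * S n k         ≈⟨ *-assoc _ _ _ ⟩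
  invFactorial k * (fromℕ (k !) * S n k)         ≈⟨ *-congˡ (binomialMoment-degEulerian λ' n (S n) (expand n) k k≤n) ⟨
  invFactorial k * binomialMoment n (degEulerian (- λ') n) (n ∸ k) ∎
  where
  open CharZeroField F
  open Eulerian commutativeRing using (binomialMoment; binomialMoment-degEulerian)
  open ≈-Reasoning setoid
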